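{- Let $n\ge2$ be such that there exist two $n$-good pairs. Then $n$ is not $\frac12$-paradoxical; that is, $n\in D$ if and only if $N(\phi n)=\lfloor\phi n\rfloor$.
   Context: $\phi=(1+\sqrt5)/2$; $N(x)$ is the integer closest to $x$. For positive integers $a_1,a_2$, the $(a_1,a_2)$-Fibonacci walk is $w_k=w_k(a_1,a_2)$ with $w_1=a_1$, $w_2=a_2$, $w_{k+2}=w_{k+1}+w_k$. Let $s(n;a_1,a_2)$ be the integer $s$ with $w_s(a_1,a_2)=n$ ($-\infty$ if none), and $s(n)=\max_{a_1,a_2\ge1}s(n;a_1,a_2)$. A pair $(a_1,a_2)$ is $n$-good if $a_1,a_2\ge1$ and $s(n;a_1,a_2)=s(n)$; its walk is then an $n$-slow Fibonacci walk. An integer $n\ge2$ is in $D$ if $w_{s(n)+1}=\lfloor\phi n\rfloor$ for some $n$-slow walk, and in $U$ if $w_{s(n)+1}=\lceil\phi n\rceil$ for some $n$-slow walk. Let $\delta_n=\phi n-\lfloor\phi n\rfloor$, $\Delta_n=\lceil\phi n\rceil-\phi n$; $n$ is $d$-paradoxical if either ($\delta_n<d$ and $n\in U$) or ($\Delta_n<d$ and $n\in D$). -}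

module Defs where

open import Data.Nat using (ℕ; zero; suc; _+_; _*_; _∸_; _≤_; _<_)
open import Data.Product using (Σ; _×_; ∃; ∃-syntax; _,_)
open import Relation.Nullary using (¬_)
open import Relation.Binary.PropositionalEquality using (_≡_)
open import Function.Bundles using (_⇔_)
open import Data.Sum using (_⊎_)

-- φ = (1+√5)/2.  All comparisons with φ·n are reduced to exact ℕ arithmetic.
-- For x, n : ℕ:   x ≤ φ n  ⇔  2x - n ≤ √5 n  ⇔  (2x ∸ n)² ≤ 5n²   (truncated ∸ handles 2x ≤ n).
LePhi : ℕ → ℕ → Set
LePhi n x = (2 * x ∸ n) * (2 * x ∸ n) ≤ 5 * (n * n)

LtPhi : ℕ → ℕ → Set
LtPhi n x = (2 * x ∸ n) * (2 * x ∸ n) < 5 * (n * n)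

-- y < 2 φ n = n + √5 n  ⇔  (y ∸ n)² < 5n²
Lt2Phi : ℕ → ℕ → Set
Lt2Phi n y = (y ∸ n) * (y ∸ n) < 5 * (n * n)

IsFloorPhi : ℕ → ℕ → Set
IsFloorPhi n m = LePhi n m × (∀ k → LePhi n k → k ≤ m)

-- m = ⌈φ n⌉ : the least natural number ≥ φ n  (φ n ≤ k  ⇔  ¬ (k < φ n))
IsCeilPhi : ℕ → ℕ → Set
IsCeilPhi n m = ¬ LtPhi n m × (∀ k → ¬ LtPhi n k → m ≤ k)

Le2Phi : ℕ → ℕ → Set
Le2Phi n y = (y ∸ n) * (y ∸ n) ≤ 5 * (n * n)

-- δ_n < 1/2, where m = ⌊φ n⌋ :  φn - m < 1/2  ⇔  2φn < 2m+1  ⇔  ¬ (2m+1 ≤ 2φn)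
SmallDelta : ℕ → Set
SmallDelta n = ∃[ m ] (IsFloorPhi n m × ¬ Le2Phi n (2 * m + 1))

-- Δ_n < 1/2, where m = ⌈φ n⌉ :  m - φn < 1/2  ⇔  2m - 1 < 2φn
SmallDeltaUp : ℕ → Set
SmallDeltaUp n = ∃[ m ] (IsCeilPhi n m × Lt2Phi n (2 * m ∸ 1))

-- N(φ n) = ⌊φ n⌋ : the nearest integer to φ n is its floor, i.e. δ_n < 1/2
NearestIsFloor : ℕ → Set
NearestIsFloor n = SmallDelta n

-- Fibonacci walk, paper indexing: w a b 1 = a, w a b 2 = b, w_{k+2} = w_{k+1} + w_k.
-- (index 0 is unused; we set w a b 0 = b ∸ a, irrelevant below since indices are ≥ 1)
w : ℕ → ℕ → ℕ → ℕ
w a b zero = b ∸ a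
w a b (suc zero) = a
w a b (suc (suc zero)) = b
w a b (suc (suc (suc k))) = w a b (suc (suc k)) + w a b (suc k)

IsS : ℕ → ℕ → Set
IsS n s = (1 ≤ s × ∃[ a ] ∃[ b ] (1 ≤ a × 1 ≤ b × w a b s ≡ n))
        × (∀ a b t → 1 ≤ a → 1 ≤ b → 1 ≤ t → w a b t ≡ n → t ≤ s)

-- (a,b) is n-good: a,b ≥ 1 and s(n;a,b) = s(n), i.e. the walk hits n at index s(n)
-- (s(n;a,b) ≤ s(n) always, so this is the same as its largest hitting index being s(n)).
Good : ℕ → ℕ → ℕ → Set
Good n a b = ∃[ s ] (IsS n s × 1 ≤ a × 1 ≤ b × w a b s ≡ n)

InD : ℕ → Set
InD n = ∃[ a ] ∃[ b ] ∃[ s ] (IsS n s × 1 ≤ a × 1 ≤ b × w a b s ≡ n × IsFloorPhi n (w a b (suc s)))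

InU : ℕ → Set
InU n = ∃[ a ] ∃[ b ] ∃[ s ] (IsS n s × 1 ≤ a × 1 ≤ b × w a b s ≡ n × IsCeilPhi n (w a b (suc s)))

HalfParadoxical : ℕ → Set
HalfParadoxical n = (SmallDelta n × InU n) ⊎ (SmallDeltaUp n × InD n)

{-# OPTIONS --safe #-}
module Submission where

-- Let s(n) = j + 3, p = F_{j+1}, q = F_{j+2}. An n-slow walk starting at (a, b) satisfies
-- p a + q b = n and b ≤ a, and along any walk |w_{k+1}² − w_k w_{k+1} − w_k²| is constant
-- while its sign alternates. So every n-slow walk puts w_{s+1} on the same side of φn,
-- decided by the parity of s. Two distinct good pairs differ by a multiple of (q, −p), p and q
-- being coprime, which yields a good pair with a ≤ q ≤ 2p < p + b; for that walk the Cassini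
-- gap c satisfies 4c + 2n + 2 ≤ 4w_{s+1}, and since (2w_{s+1} − n)² = 5n² ∓ 4c this forces
-- |w_{s+1} − φn| < 1/2. Hence the nearest integer to φn lies on the side of all slow walks.

open import Defs
open import Data.Nat using (ℕ; zero; suc; _+_; _*_; _∸_; _≤_; _<_; z≤n; s≤s; _≤?_; >-nonZero)
open import Data.Nat.Properties
open import Data.Nat.Coprimality using (Coprime; coprime-divisor; coprime-+; gcd≡1⇒coprime)
import Data.Nat.Coprimality as Coprime
open import Data.Nat.Divisibility using (divides; ∣⇒≤)
open import Data.Nat.Induction using (<-wellFounded)
open import Data.Nat.Tactic.RingSolver using (solve-∀)
open import Induction.WellFounded using (Acc; acc)
open import Data.Product using (_×_; ∃-syntax; _,_; proj₁; proj₂)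
open import Data.Sum using (inj₁; inj₂)
open import Data.Empty using (⊥-elim)
open import Relation.Nullary using (¬_; yes; no; contradiction)
open import Relation.Binary using (tri<; tri≈; tri>)
open import Relation.Binary.PropositionalEquality
open import Function.Base using (_∘_)
open import Function.Bundles using (_⇔_; mk⇔)

fib : ℕ → ℕ
fib k = w 0 1 (suc k)

w-fib-expansion : ∀ a b k → w a b (suc (suc k)) ≡ fib k * a + fib (suc k) * b
w-fib-expansion a b zero = sym (+-identityʳ b)
w-fib-expansion a b (suc zero) = base a b
  where
  base : ∀ a b → b + a ≡ 1 * a + 1 * b
  base = solve-∀
w-fib-expansion a b (suc (suc k)) = begin
  w a b (3 + k) + w a b (2 + k)                  ≡⟨ cong₂ _+_ (w-fib-expansion a b (suc k)) (w-fib-expansion a b k) ⟩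
  (f₁ * a + (f₁ + f₀) * b) + (f₀ * a + f₁ * b)   ≡⟨ regroup f₀ f₁ a b ⟩
  (f₁ + f₀) * a + ((f₁ + f₀) + f₁) * b           ∎
  where
  open ≡-Reasoning
  f₀ = fib k
  f₁ = fib (suc k)
  regroup : ∀ f₀ f₁ a b → (f₁ * a + (f₁ + f₀) * b) + (f₀ * a + f₁ * b) ≡ (f₁ + f₀) * a + ((f₁ + f₀) + f₁) * b
  regroup = solve-∀

fib-mono : ∀ k → fib k ≤ fib (suc k)
fib-mono zero = z≤n
fib-mono (suc k) = m≤m+n (fib (suc k)) (fib k)

fib-pos : ∀ k → 1 ≤ fib (suc k)
fib-pos zero = s≤s z≤n
fib-pos (suc k) = ≤-trans (fib-pos k) (fib-mono (suc k))

fib-≤-double : ∀ k → fib (suc (suc k)) ≤ fib (suc k) + fib (suc k)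
fib-≤-double k = +-monoʳ-≤ (fib (suc k)) (fib-mono k)

fib-coprime : ∀ k → Coprime (fib k) (fib (suc k))
fib-coprime zero = gcd≡1⇒coprime refl
fib-coprime (suc k) = Coprime.sym (coprime-+ (fib-coprime k))

w-prepend : ∀ {x a b} → x + a ≡ b → ∀ k → w x a (suc (suc k)) ≡ w a b (suc k)
w-prepend e zero = refl
w-prepend {x} {a} e (suc zero) = trans (+-comm a x) e
w-prepend e (suc (suc k)) = cong₂ _+_ (w-prepend e (suc k)) (w-prepend e k)

IsS-unique : ∀ {n s t} → IsS n s → IsS n t → s ≡ t
IsS-unique ((s≥1 , a , b , a≥1 , b≥1 , e) , s-max) ((t≥1 , c , d , c≥1 , d≥1 , e′) , t-max) =
  ≤-antisym (t-max a b _ a≥1 b≥1 s≥1 e) (s-max c d _ c≥1 d≥1 t≥1 e′)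

-- n = w 1 (n ∸ 1) 3.
IsS-≥3 : ∀ {n s} → 2 ≤ n → IsS n s → 3 ≤ s
IsS-≥3 {suc zero} (s≤s ()) _
IsS-≥3 {suc (suc n)} _ (_ , s-max) = s-max 1 (suc n) 3 (s≤s z≤n) (s≤s z≤n) (s≤s z≤n) (+-comm (suc n) 1)

-- Otherwise the walk could be extended backwards by b ∸ a, reaching n one step later.
slow-walk-decreasing : ∀ {n k a b} → IsS n (suc k) → 1 ≤ a → 1 ≤ b → w a b (suc k) ≡ n → b ≤ a
slow-walk-decreasing {n} {k} {a} {b} (_ , s-max) a≥1 _ e with b ≤? a
... | yes b≤a = b≤a
... | no b≰a = contradiction (s-max (b ∸ a) a (suc (suc k)) (m<n⇒0<n∸m a<b) a≥1 (s≤s z≤n) e′) (<-irrefl refl)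
  where
  a<b : a < b
  a<b = ≰⇒> b≰a
  e′ : w (b ∸ a) a (suc (suc k)) ≡ n
  e′ = trans (w-prepend (m∸n+n≡m (<⇒≤ a<b)) k) e

data Side : Set where
  below above : Side

flip : Side → Side
flip below = above
flip above = below

parity : ℕ → Side
parity zero = below
parity (suc k) = flip (parity k)

-- c = |y² − xy − x²|, the side recording the sign of y² − xy − x², i.e. whether y < φx.
Cassini : Side → ℕ → ℕ → ℕ → Set
Cassini below x y c = y * y + c ≡ x * y + x * x
Cassini above x y c = y * y ≡ x * y + x * x + c

cancel-by : ∀ {l r u v} → u ≡ v → l + u ≡ r + v → l ≡ r
cancel-by {l} {r} {u} refl e = +-cancelʳ-≡ u l r e

Cassini-step : ∀ σ x y c → Cassini σ x y c → Cassini (flip σ) y (y + x) c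
Cassini-step below x y c h = cancel-by h (expand x y c)
  where
  expand : ∀ x y c → (y + x) * (y + x) + (y * y + c) ≡ (y * (y + x) + y * y + c) + (x * y + x * x)
  expand = solve-∀
Cassini-step above x y c h = cancel-by h (expand x y c)
  where
  expand : ∀ x y c → ((y + x) * (y + x) + c) + y * y ≡ (y * (y + x) + y * y) + (x * y + x * x + c)
  expand = solve-∀

walk-Cassini : ∀ {a b c} → Cassini below a b c → ∀ k → Cassini (parity k) (w a b (suc k)) (w a b (suc (suc k))) c
walk-Cassini h zero = h
walk-Cassini {c = c} h (suc k) = Cassini-step (parity k) _ _ c (walk-Cassini h k)

Cassini-initial : ∀ {a b} → 1 ≤ a → b ≤ a → ∃[ c ] (1 ≤ c × Cassini below a b c)
Cassini-initial {a} {b} a≥1 b≤a = a * b + a * a ∸ b * b , c≥1 , trans (+-comm (b * b) _) (m∸n+n≡m bb≤)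
  where
  bb≤ : b * b ≤ a * b + a * a
  bb≤ = ≤-trans (*-monoˡ-≤ b b≤a) (m≤m+n (a * b) (a * a))
  c≥1 : 1 ≤ a * b + a * a ∸ b * b
  c≥1 = ≤-trans (*-mono-≤ a≥1 a≥1)
    (subst (_≤ a * b + a * a ∸ b * b) (m+n∸m≡n (a * b) (a * a)) (∸-monoʳ-≤ (a * b + a * a) (*-monoˡ-≤ b b≤a)))

-- Multiplying by 4 and completing the square in y: (2y − x)² = 5x² ∓ 4c.
square-below : ∀ X n c → (X + n) * (X + n) + 4 * c ≡ 2 * n * (X + n) + 4 * (n * n) → X * X + 4 * c ≡ 5 * (n * n)
square-below X n c h = cancel-by (sym h) (expand X n c)
  where
  expand : ∀ X n c → X * X + 4 * c + (2 * n * (X + n) + 4 * (n * n)) ≡ 5 * (n * n) + ((X + n) * (X + n) + 4 * c)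
  expand = solve-∀

square-above : ∀ X n c → (X + n) * (X + n) ≡ 2 * n * (X + n) + 4 * (n * n) + 4 * c → X * X ≡ 5 * (n * n) + 4 * c
square-above X n c h = cancel-by (sym h) (expand X n c)
  where
  expand : ∀ X n c → X * X + (2 * n * (X + n) + 4 * (n * n) + 4 * c) ≡ 5 * (n * n) + 4 * c + (X + n) * (X + n)
  expand = solve-∀

[2m∸n]+n≡2m : ∀ {n m} → n ≤ m → (2 * m ∸ n) + n ≡ 2 * m
[2m∸n]+n≡2m {n} {m} n≤m = m∸n+n≡m (≤-trans n≤m (m≤m+n m (m + 0)))

Cassini-below-square : ∀ {n m c} → n ≤ m → Cassini below n m c → (2 * m ∸ n) * (2 * m ∸ n) + 4 * c ≡ 5 * (n * n)
Cassini-below-square {n} {m} {c} n≤m h = square-below X n c (begin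
  (X + n) * (X + n) + 4 * c       ≡⟨ cong (λ t → t * t + 4 * c) ([2m∸n]+n≡2m n≤m) ⟩
  (2 * m) * (2 * m) + 4 * c       ≡⟨ times4 m c ⟩
  4 * (m * m + c)                 ≡⟨ cong (4 *_) h ⟩
  4 * (n * m + n * n)             ≡⟨ times4′ n m ⟩
  2 * n * (2 * m) + 4 * (n * n)   ≡⟨ cong (λ t → 2 * n * t + 4 * (n * n)) (sym ([2m∸n]+n≡2m n≤m)) ⟩
  2 * n * (X + n) + 4 * (n * n)   ∎)
  where
  open ≡-Reasoning
  X = 2 * m ∸ n
  times4 : ∀ m c → (2 * m) * (2 * m) + 4 * c ≡ 4 * (m * m + c)
  times4 = solve-∀
  times4′ : ∀ n m → 4 * (n * m + n * n) ≡ 2 * n * (2 * m) + 4 * (n * n)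
  times4′ = solve-∀

Cassini-above-square : ∀ {n m c} → n ≤ m → Cassini above n m c → (2 * m ∸ n) * (2 * m ∸ n) ≡ 5 * (n * n) + 4 * c
Cassini-above-square {n} {m} {c} n≤m h = square-above X n c (begin
  (X + n) * (X + n)                        ≡⟨ cong (λ t → t * t) ([2m∸n]+n≡2m n≤m) ⟩
  (2 * m) * (2 * m)                        ≡⟨ times4 m ⟩
  4 * (m * m)                              ≡⟨ cong (4 *_) h ⟩
  4 * (n * m + n * n + c)                  ≡⟨ times4′ n m c ⟩
  2 * n * (2 * m) + 4 * (n * n) + 4 * c    ≡⟨ cong (λ t → 2 * n * t + 4 * (n * n) + 4 * c) (sym ([2m∸n]+n≡2m n≤m)) ⟩
  2 * n * (X + n) + 4 * (n * n) + 4 * c    ∎)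
  where
  open ≡-Reasoning
  X = 2 * m ∸ n
  times4 : ∀ m → (2 * m) * (2 * m) ≡ 4 * (m * m)
  times4 = solve-∀
  times4′ : ∀ n m c → 4 * (n * m + n * n + c) ≡ 2 * n * (2 * m) + 4 * (n * n) + 4 * c
  times4′ = solve-∀

Cassini-below⇒LtPhi : ∀ {n m c} → 1 ≤ c → n ≤ m → Cassini below n m c → LtPhi n m
Cassini-below⇒LtPhi {n} {m} {c} c≥1 n≤m h =
  subst (X * X <_) (Cassini-below-square n≤m h) (m<m+n (X * X) (≤-trans c≥1 (m≤m+n c (3 * c))))
  where
  X = 2 * m ∸ n

Cassini-above⇒¬LePhi : ∀ {n m c} → 1 ≤ c → n ≤ m → Cassini above n m c → ¬ LePhi n m
Cassini-above⇒¬LePhi {n} {c = c} c≥1 n≤m h =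
  <⇒≱ (subst (5 * (n * n) <_) (sym (Cassini-above-square n≤m h)) (m<m+n _ (≤-trans c≥1 (m≤m+n c (3 * c)))))

square-lt-next : ∀ X k → k ≤ 2 * X → X * X + k < (X + 1) * (X + 1)
square-lt-next X k k≤2X = subst (X * X + k <_) (sym (expand X)) (+-monoʳ-< (X * X) (s≤s (≤-trans k≤2X (m≤m+n (2 * X) 0))))
  where
  expand : ∀ X → (X + 1) * (X + 1) ≡ X * X + suc (2 * X + 0)
  expand = solve-∀

pred-square-lt : ∀ X N k → X * X ≡ N + k → k + 2 ≤ 2 * X → (X ∸ 1) * (X ∸ 1) < N
pred-square-lt zero N k _ k+2≤0 with () ← ≤-trans (m≤n+m 2 k) k+2≤0
pred-square-lt (suc Y) N k h k+2≤ = +-cancelʳ-< (suc (2 * Y)) (Y * Y) N (begin-strict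
  Y * Y + suc (2 * Y)   ≡⟨ sym (expand Y) ⟩
  suc Y * suc Y         ≡⟨ h ⟩
  N + k                 <⟨ +-monoʳ-< N (s≤s k≤2Y) ⟩
  N + suc (2 * Y)       ∎)
  where
  open ≤-Reasoning
  expand : ∀ Y → suc Y * suc Y ≡ Y * Y + suc (2 * Y)
  expand = solve-∀
  k≤2Y : k ≤ 2 * Y
  k≤2Y = +-cancelʳ-≤ 2 k (2 * Y) (subst (k + 2 ≤_) (double-suc Y) k+2≤)
    where
    double-suc : ∀ Y → 2 * suc Y ≡ 2 * Y + 2
    double-suc = solve-∀

near-gap⇒halved : ∀ {n m c} → n ≤ m → 4 * c + 2 * n + 2 ≤ 4 * m → 4 * c + 2 ≤ 2 * (2 * m ∸ n)
near-gap⇒halved {n} {m} {c} n≤m h = +-cancelʳ-≤ (2 * n) _ _ (begin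
  4 * c + 2 + 2 * n          ≡⟨ +-assoc (4 * c) 2 (2 * n) ⟩
  4 * c + (2 + 2 * n)        ≡⟨ cong (4 * c +_) (+-comm 2 (2 * n)) ⟩
  4 * c + (2 * n + 2)        ≡⟨ +-assoc (4 * c) (2 * n) 2 ⟨
  4 * c + 2 * n + 2          ≤⟨ h ⟩
  4 * m                      ≡⟨ quadruple m ⟩
  2 * (2 * m)                ≡⟨ cong (2 *_) (sym ([2m∸n]+n≡2m n≤m)) ⟩
  2 * (X + n)                ≡⟨ *-distribˡ-+ 2 X n ⟩
  2 * X + 2 * n              ∎)
  where
  open ≤-Reasoning
  X = 2 * m ∸ n
  quadruple : ∀ m → 4 * m ≡ 2 * (2 * m)
  quadruple = solve-∀

near-below⇒¬Le2Phi : ∀ {n m c} → n ≤ m → Cassini below n m c → 4 * c + 2 * n + 2 ≤ 4 * m → ¬ Le2Phi n (2 * m + 1)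
near-below⇒¬Le2Phi {n} {m} {c} n≤m h near le = <⇒≱ lt (subst (λ t → t * t ≤ 5 * (n * n)) (+-∸-comm 1 2m≥n) le)
  where
  X = 2 * m ∸ n
  2m≥n : n ≤ 2 * m
  2m≥n = ≤-trans n≤m (m≤m+n m (m + 0))
  lt : 5 * (n * n) < (X + 1) * (X + 1)
  lt = subst (_< (X + 1) * (X + 1)) (Cassini-below-square n≤m h)
         (square-lt-next X (4 * c) (≤-trans (m≤m+n (4 * c) 2) (near-gap⇒halved {c = c} n≤m near)))

near-above⇒Lt2Phi : ∀ {n m c} → n ≤ m → Cassini above n m c → 4 * c + 2 * n + 2 ≤ 4 * m → Lt2Phi n (2 * m ∸ 1)
near-above⇒Lt2Phi {n} {m} {c} n≤m h near = subst (λ t → t * t < 5 * (n * n)) swap-∸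
  (pred-square-lt (2 * m ∸ n) (5 * (n * n)) (4 * c) (Cassini-above-square n≤m h) (near-gap⇒halved {c = c} n≤m near))
  where
  swap-∸ : 2 * m ∸ n ∸ 1 ≡ 2 * m ∸ 1 ∸ n
  swap-∸ = trans (∸-+-assoc (2 * m) n 1) (trans (cong (2 * m ∸_) (+-comm n 1)) (sym (∸-+-assoc (2 * m) 1 n)))

square-∸-mono : ∀ n {x y} → x ≤ y → (x ∸ n) * (x ∸ n) ≤ (y ∸ n) * (y ∸ n)
square-∸-mono n x≤y = *-mono-≤ (∸-monoˡ-≤ n x≤y) (∸-monoˡ-≤ n x≤y)

LePhi-antitone : ∀ n {k l} → k ≤ l → LePhi n l → LePhi n k
LePhi-antitone n k≤l = ≤-trans (square-∸-mono n (*-monoʳ-≤ 2 k≤l))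

LtPhi-antitone : ∀ n {k l} → k ≤ l → LtPhi n l → LtPhi n k
LtPhi-antitone n k≤l = ≤-<-trans (square-∸-mono n (*-monoʳ-≤ 2 k≤l))

Le2Phi-antitone : ∀ n {k l} → k ≤ l → Le2Phi n l → Le2Phi n k
Le2Phi-antitone n k≤l = ≤-trans (square-∸-mono n k≤l)

Lt2Phi⇒Le2Phi-below : ∀ n {k l} → k ≤ l → Lt2Phi n l → Le2Phi n k
Lt2Phi⇒Le2Phi-below n k≤l lt = <⇒≤ (≤-<-trans (square-∸-mono n k≤l) lt)

double-suc∸1 : ∀ f → 2 * suc f ∸ 1 ≡ 2 * f + 1
double-suc∸1 f = cong (_∸ 1) (expand f)
  where
  expand : ∀ f → 2 * suc f ≡ suc (2 * f + 1)
  expand = solve-∀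

double∸1-mono : ∀ {k l} → k ≤ l → 2 * k ∸ 1 ≤ 2 * l ∸ 1
double∸1-mono k≤l = ∸-monoˡ-≤ 1 (*-monoʳ-≤ 2 k≤l)

-- 2(m + 1) > 2m + 1, so δ < 1/2 already forbids m + 1 ≤ φn.
floor-by-gap : ∀ {n m} → LtPhi n m → ¬ Le2Phi n (2 * m + 1) → IsFloorPhi n m
floor-by-gap {n} {m} lt ¬le = <⇒≤ lt , maximal
  where
  maximal : ∀ k → LePhi n k → k ≤ m
  maximal k le with k ≤? m
  ... | yes k≤m = k≤m
  ... | no k≰m = contradiction
    (Le2Phi-antitone n (≤-trans (n≤1+n (2 * m + 1)) (≤-reflexive (cong suc (sym (double-suc∸1 m)))))
      (LePhi-antitone n (≰⇒> k≰m) le)) ¬le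

-- The strict m < φn replaces the irrationality of φn (for n = 0 both δ and Δ vanish).
below-gap⇒¬SmallDeltaUp : ∀ {n m} → LtPhi n m → ¬ Le2Phi n (2 * m + 1) → ¬ SmallDeltaUp n
below-gap⇒¬SmallDeltaUp {n} {m} lt ¬le (g , (¬lt-g , _) , lt′) with g ≤? m
... | yes g≤m = ¬lt-g (LtPhi-antitone n g≤m lt)
... | no g≰m = ¬le (Lt2Phi⇒Le2Phi-below n (subst (_≤ 2 * g ∸ 1) (double-suc∸1 m) (double∸1-mono (≰⇒> g≰m))) lt′)

above-gap⇒¬SmallDelta : ∀ {n m} → ¬ LePhi n m → Lt2Phi n (2 * m ∸ 1) → ¬ SmallDelta n
above-gap⇒¬SmallDelta {n} {m} ¬le lt (f , (le-f , _) , ¬le′) with m ≤? f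
... | yes m≤f = ¬le (LePhi-antitone n m≤f le-f)
... | no m≰f = ¬le′ (Lt2Phi⇒Le2Phi-below n (subst (_≤ 2 * m ∸ 1) (double-suc∸1 f) (double∸1-mono (≰⇒> m≰f))) lt)

SlowCassini : Side → ℕ → Set
SlowCassini σ n = ∀ a b s → IsS n s → 1 ≤ a → 1 ≤ b → w a b s ≡ n →
  n ≤ w a b (suc s) × ∃[ c ] (1 ≤ c × Cassini σ n (w a b (suc s)) c)

SlowCassini⇒conclusion : ∀ σ {n a b s c} → SlowCassini σ n → IsS n s → 1 ≤ a → 1 ≤ b → w a b s ≡ n →
  Cassini σ n (w a b (suc s)) c → 4 * c + 2 * n + 2 ≤ 4 * w a b (suc s) →
  ¬ HalfParadoxical n × (InD n ⇔ NearestIsFloor n)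
SlowCassini⇒conclusion below {n} {a} {b} {s} slow isS a≥1 b≥1 e h near = ¬paradoxical , mk⇔ (λ _ → small) (λ _ → inD)
  where
  slow-below : ∀ a b s → IsS n s → 1 ≤ a → 1 ≤ b → w a b s ≡ n → LtPhi n (w a b (suc s))
  slow-below a b s isS a≥1 b≥1 e with slow a b s isS a≥1 b≥1 e
  ... | n≤m , c , c≥1 , h = Cassini-below⇒LtPhi {n} c≥1 n≤m h
  m = w a b (suc s)
  ¬le : ¬ Le2Phi n (2 * m + 1)
  ¬le = near-below⇒¬Le2Phi {n} (proj₁ (slow a b s isS a≥1 b≥1 e)) h near
  floor : IsFloorPhi n m
  floor = floor-by-gap {n} (slow-below a b s isS a≥1 b≥1 e) ¬le
  small : NearestIsFloor n
  small = m , floor , ¬le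
  inD : InD n
  inD = a , b , s , isS , a≥1 , b≥1 , e , floor
  ¬paradoxical : ¬ HalfParadoxical n
  ¬paradoxical (inj₁ (_ , a′ , b′ , s′ , isS′ , a′≥1 , b′≥1 , e′ , ceil)) =
    proj₁ ceil (slow-below a′ b′ s′ isS′ a′≥1 b′≥1 e′)
  ¬paradoxical (inj₂ (up , _)) = below-gap⇒¬SmallDeltaUp {n} {m} (slow-below a b s isS a≥1 b≥1 e) ¬le up
SlowCassini⇒conclusion above {n} {a} {b} {s} slow isS a≥1 b≥1 e h near = ¬paradoxical , mk⇔ (⊥-elim ∘ ¬inD) (⊥-elim ∘ ¬small)
  where
  slow-above : ∀ a b s → IsS n s → 1 ≤ a → 1 ≤ b → w a b s ≡ n → ¬ LePhi n (w a b (suc s))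
  slow-above a b s isS a≥1 b≥1 e with slow a b s isS a≥1 b≥1 e
  ... | n≤m , c , c≥1 , h = Cassini-above⇒¬LePhi {n} c≥1 n≤m h
  ¬small : ¬ NearestIsFloor n
  ¬small = above-gap⇒¬SmallDelta {n} {w a b (suc s)} (slow-above a b s isS a≥1 b≥1 e)
    (near-above⇒Lt2Phi {n} {w a b (suc s)} (proj₁ (slow a b s isS a≥1 b≥1 e)) h near)
  ¬inD : ¬ InD n
  ¬inD (a′ , b′ , s′ , isS′ , a′≥1 , b′≥1 , e′ , floor) = slow-above a′ b′ s′ isS′ a′≥1 b′≥1 e′ (proj₁ floor)
  ¬paradoxical : ¬ HalfParadoxical n
  ¬paradoxical (inj₁ (small , _)) = ¬small small
  ¬paradoxical (inj₂ (_ , d)) = ¬inD d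

PositiveSolution : ℕ → ℕ → ℕ → ℕ → ℕ → Set
PositiveSolution p q n x y = 1 ≤ x × 1 ≤ y × p * x + q * y ≡ n

-- q (y − y′) is a positive multiple of p, hence at least p.
coprime-excess : ∀ {p q u y y′} → Coprime p q → 1 ≤ p → q * y ≡ p * suc u + q * y′ → y′ + p ≤ y
coprime-excess {p} {q} {u} {y} {y′} cop p≥1 e with m≤n⇒∃[o]m+o≡n y′<y
  where
  y′<y : y′ < y
  y′<y = *-cancelˡ-< q y′ y (subst (q * y′ <_) (sym e) (m<n+m (q * y′) (*-mono-≤ p≥1 (s≤s z≤n))))
... | v , refl = subst (y′ + p ≤_) (+-suc y′ v) (+-monoʳ-≤ y′ p≤1+v)
  where
  qv≡ : q * suc v ≡ p * suc u
  qv≡ = +-cancelʳ-≡ (q * y′) _ _ (trans (split q y′ v) e)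
    where
    split : ∀ q y′ v → q * suc v + q * y′ ≡ q * (suc y′ + v)
    split = solve-∀
  p≤1+v : p ≤ suc v
  p≤1+v = ∣⇒≤ (coprime-divisor cop (divides (suc u) (trans qv≡ (*-comm p (suc u)))))

coprime-solutions-gap : ∀ {p q x y x′ y′} → Coprime p q → 1 ≤ p →
  p * x + q * y ≡ p * x′ + q * y′ → x < x′ → y′ + p ≤ y
coprime-solutions-gap {p} {q} {x} {y′ = y′} cop p≥1 e x<x′ with m≤n⇒∃[o]m+o≡n x<x′
... | u , refl = coprime-excess cop p≥1 (+-cancelˡ-≡ (p * x) _ _ (trans e (split p q x u y′)))
  where
  split : ∀ p q x u y′ → p * (suc x + u) + q * y′ ≡ p * x + (p * suc u + q * y′)
  split = solve-∀

distinct-solutions⇒large-y : ∀ {p q n x y x′ y′} → Coprime p q → 1 ≤ p → 1 ≤ q →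
  PositiveSolution p q n x y → PositiveSolution p q n x′ y′ → ¬ (x ≡ x′ × y ≡ y′) →
  ∃[ x ] ∃[ y ] (PositiveSolution p q n x y × 1 + p ≤ y)
distinct-solutions⇒large-y {p} {q} {x = x} {y} {x′} {y′} cop p≥1 q≥1 sol@(_ , _ , e) sol′@(_ , y′≥1 , e′) distinct
  with <-cmp x x′
... | tri< x<x′ _ _ = x , y , sol , ≤-trans (+-monoˡ-≤ p y′≥1) (coprime-solutions-gap cop p≥1 (trans e (sym e′)) x<x′)
... | tri> _ _ x′<x = x′ , y′ , sol′ , ≤-trans (+-monoˡ-≤ p (proj₁ (proj₂ sol))) (coprime-solutions-gap cop p≥1 (trans e′ (sym e)) x′<x)
... | tri≈ _ refl _ = contradiction (refl , y≡y′) distinct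
  where
  y≡y′ : y ≡ y′
  y≡y′ = *-cancelˡ-≡ y y′ q {{>-nonZero q≥1}} (+-cancelˡ-≡ (p * x) _ _ (trans e (sym e′)))

-- Trading q from x for p in y preserves p x + q y; repeat until x ≤ q.
reduce-solution : ∀ {p q n} → 1 ≤ q → ∀ x y → PositiveSolution p q n x y → 1 + p ≤ y →
  ∃[ x ] ∃[ y ] (PositiveSolution p q n x y × x ≤ q × 1 + p ≤ y)
reduce-solution {p} {q} {n} q≥1 x = go x (<-wellFounded x)
  where
  go : ∀ x → Acc _<_ x → ∀ y → PositiveSolution p q n x y → 1 + p ≤ y →
    ∃[ x ] ∃[ y ] (PositiveSolution p q n x y × x ≤ q × 1 + p ≤ y)
  go x (acc smaller) y sol y-large with x ≤? q
  ... | yes x≤q = x , y , sol , x≤q , y-large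
  ... | no x≰q with m≤n⇒∃[o]m+o≡n (≰⇒> x≰q)
  ... | t , refl = go (suc t) (smaller (s≤s (+-monoˡ-≤ t q≥1))) (y + p) sol′ (≤-trans y-large (m≤m+n y p))
    where
    trade : ∀ p q t y → p * suc t + q * (y + p) ≡ p * (suc q + t) + q * y
    trade = solve-∀
    sol′ : PositiveSolution p q n (suc t) (y + p)
    sol′ = s≤s z≤n , ≤-trans (proj₁ (proj₂ sol)) (m≤m+n y p) , trans (trade p q t y) (proj₂ (proj₂ sol))

near-pair-gap : ∀ {p q a b c} → 1 + p ≤ b → b ≤ a → a ≤ q → q ≤ p + p → Cassini below a b c →
  4 * c + 2 * (p * a + q * b) + 2 ≤ 4 * (q * a + (q + p) * b)
near-pair-gap {p} {q} {a} {b} {c} p<b b≤a a≤q q≤2p h = +-cancelʳ-≤ (4 * (b * b)) _ _ (begin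
  4 * c + 2 * (p * a + q * b) + 2 + 4 * (b * b)      ≡⟨ use-Cassini ⟩
  4 * (a * b + a * a) + 2 * (p * a + q * b) + 2      ≤⟨ +-monoʳ-≤ _ 2≤4b ⟩
  4 * (a * b + a * a) + 2 * (p * a + q * b) + 4 * b  ≡⟨ regroup p q a b ⟩
  4 * (a * a) + 4 * ((a + 1) * b) + 2 * (p * a) + 2 * (q * b)
    ≤⟨ +-monoˡ-≤ (2 * (q * b)) (+-mono-≤ (+-mono-≤ (*-monoʳ-≤ 4 aa≤qa) (*-monoʳ-≤ 4 [a+1]b≤[p+b]b)) (*-monoʳ-≤ 2 pa≤qb)) ⟩
  4 * (q * a) + 4 * ((p + b) * b) + 2 * (q * b) + 2 * (q * b)
                                                     ≡⟨ regroup′ p q a b ⟩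
  4 * (q * a + (q + p) * b) + 4 * (b * b)            ∎)
  where
  open ≤-Reasoning
  use-Cassini : 4 * c + 2 * (p * a + q * b) + 2 + 4 * (b * b) ≡ 4 * (a * b + a * a) + 2 * (p * a + q * b) + 2
  use-Cassini = trans (move p q a b c) (cong (λ t → 4 * t + 2 * (p * a + q * b) + 2) h)
    where
    move : ∀ p q a b c → 4 * c + 2 * (p * a + q * b) + 2 + 4 * (b * b) ≡ 4 * (b * b + c) + 2 * (p * a + q * b) + 2
    move = solve-∀
  regroup : ∀ p q a b → 4 * (a * b + a * a) + 2 * (p * a + q * b) + 4 * b
                      ≡ 4 * (a * a) + 4 * ((a + 1) * b) + 2 * (p * a) + 2 * (q * b)
  regroup = solve-∀
  regroup′ : ∀ p q a b → 4 * (q * a) + 4 * ((p + b) * b) + 2 * (q * b) + 2 * (q * b)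
                       ≡ 4 * (q * a + (q + p) * b) + 4 * (b * b)
  regroup′ = solve-∀
  2≤4b : 2 ≤ 4 * b
  2≤4b = ≤-trans (s≤s (s≤s z≤n)) (*-monoʳ-≤ 4 (≤-trans (m≤m+n 1 p) p<b))
  aa≤qa : a * a ≤ q * a
  aa≤qa = *-monoˡ-≤ a a≤q
  [a+1]b≤[p+b]b : (a + 1) * b ≤ (p + b) * b
  [a+1]b≤[p+b]b = *-monoˡ-≤ b (begin
    a + 1        ≤⟨ +-monoˡ-≤ 1 (≤-trans a≤q q≤2p) ⟩
    p + p + 1    ≡⟨ +-assoc p p 1 ⟩
    p + (p + 1)  ≤⟨ +-monoʳ-≤ p (subst (_≤ b) (+-comm 1 p) p<b) ⟩
    p + b        ∎)
  pa≤qb : p * a ≤ q * b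
  pa≤qb = ≤-trans (*-monoʳ-≤ p a≤q) (subst (_≤ q * b) (*-comm q p) (*-monoʳ-≤ q (≤-trans (m≤n+m p 1) p<b)))

module _ {n j : ℕ} (isS : IsS n (3 + j)) where

  private
    p q : ℕ
    p = fib (suc j)
    q = fib (suc (suc j))

  slow-walk⇒Cassini : ∀ {a b c} → w a b (3 + j) ≡ n → Cassini below a b c → Cassini (parity (2 + j)) n (w a b (4 + j)) c
  slow-walk⇒Cassini {c = c} e h = subst (λ t → Cassini (parity (2 + j)) t _ c) e (walk-Cassini h (2 + j))

  slow-Cassini : SlowCassini (parity (2 + j)) n
  slow-Cassini a b s isS′ a≥1 b≥1 e with IsS-unique isS isS′
  ... | refl with Cassini-initial a≥1 (slow-walk-decreasing isS a≥1 b≥1 e)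
  ... | c , c≥1 , h = subst (_≤ w a b (4 + j)) e (m≤m+n _ _) , c , c≥1 , slow-walk⇒Cassini e h

  slow-walk⇒solution : ∀ {a b} → 1 ≤ a → 1 ≤ b → w a b (3 + j) ≡ n → PositiveSolution p q n a b
  slow-walk⇒solution {a} {b} a≥1 b≥1 e = a≥1 , b≥1 , trans (sym (w-fib-expansion a b (suc j))) e

  near-solution⇒conclusion : ∀ {a b} → PositiveSolution p q n a b → a ≤ q → 1 + p ≤ b →
    ¬ HalfParadoxical n × (InD n ⇔ NearestIsFloor n)
  near-solution⇒conclusion {a} {b} (a≥1 , b≥1 , e) a≤q p<b =
    SlowCassini⇒conclusion (parity (2 + j)) slow-Cassini isS a≥1 b≥1 e′ (slow-walk⇒Cassini e′ h)
      (subst₂ (λ n′ m → 4 * c + 2 * n′ + 2 ≤ 4 * m) e (sym (w-fib-expansion a b (suc (suc j))))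
        (near-pair-gap p<b b≤a a≤q (fib-≤-double j) h))
    where
    e′ : w a b (3 + j) ≡ n
    e′ = trans (w-fib-expansion a b (suc j)) e
    b≤a : b ≤ a
    b≤a = slow-walk-decreasing isS a≥1 b≥1 e′
    c : ℕ
    c = proj₁ (Cassini-initial a≥1 b≤a)
    h : Cassini below a b c
    h = proj₂ (proj₂ (Cassini-initial a≥1 b≤a))

  two-slow-walks⇒conclusion : ∀ {a b a′ b′} → 1 ≤ a → 1 ≤ b → w a b (3 + j) ≡ n →
    1 ≤ a′ → 1 ≤ b′ → w a′ b′ (3 + j) ≡ n → ¬ (a ≡ a′ × b ≡ b′) →
    ¬ HalfParadoxical n × (InD n ⇔ NearestIsFloor n)
  two-slow-walks⇒conclusion a≥1 b≥1 e a′≥1 b′≥1 e′ distinct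
    with distinct-solutions⇒large-y (fib-coprime (suc j)) (fib-pos j) (fib-pos (suc j))
           (slow-walk⇒solution a≥1 b≥1 e) (slow-walk⇒solution a′≥1 b′≥1 e′) distinct
  ... | x , y , sol , p<y with reduce-solution (fib-pos (suc j)) x y sol p<y
  ... | x′ , y′ , sol′ , x′≤q , p<y′ = near-solution⇒conclusion sol′ x′≤q p<y′

proposition14 : (n : ℕ) → 2 ≤ n →
    (∃[ a ] ∃[ b ] ∃[ c ] ∃[ d ] (Good n a b × Good n c d × ¬ ((a ≡ c) × (b ≡ d)))) →
    ¬ HalfParadoxical n × (InD n ⇔ NearestIsFloor n)
proposition14 n 2≤n (a , b , c , d , (s , isS , a≥1 , b≥1 , e) , (s′ , isS′ , c≥1 , d≥1 , e′) , distinct)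
  with IsS-unique isS isS′ | m≤n⇒∃[o]m+o≡n (IsS-≥3 2≤n isS)
... | refl | j , refl = two-slow-walks⇒conclusion isS a≥1 b≥1 e c≥1 d≥1 e′ distinct
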